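{- Let $f:B^n\to B$, let $u,v$ be vertices of $C_f$, and let $c\ge0$ be an integer. If there is no walk in $C_f$ from $u$ to $v$ of cost at most $c-1$, and $W$ is a walk from $u$ to $v$ of cost $c+1$, then $W$ is optimal, i.e., has minimal cost among all walks from $u$ to $v$. In particular, every walk of cost $1$ from $u$ to $v$ is optimal.
   Context: $B=\{0,1\}$. $C_f$ is the boolean $n$-cube with vertex set $B^n$, two vertices adjacent iff they differ in exactly one coordinate, vertex $w$ labelled $f(w)$. A walk $W=w^1,\ldots,w^r$ is a sequence of vertices with consecutive ones adjacent; its cost is $c_W=|\{j\in\{1,\ldots,r-1\}: f(w^j)=f(w^{j+1})\}|$. -}

module Defs where

open import Data.Bool using (Bool; true; false)
open import Data.Bool.Properties using () renaming (_≟_ to _≟ᵇ_)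
open import Data.Nat using (ℕ; zero; suc; _+_; _≤_)
open import Data.Fin using (Fin)
open import Data.Vec using (Vec; lookup)
open import Data.Product using (Σ; _×_)
open import Relation.Nullary using (¬_; does)
open import Relation.Binary.PropositionalEquality using (_≡_)

Vertex : ℕ → Set
Vertex n = Vec Bool n

Adjacent : ∀ {n} → Vertex n → Vertex n → Set
Adjacent {n} u v =
  Σ (Fin n) λ i → (¬ (lookup u i ≡ lookup v i)) × ((j : Fin n) → ¬ (j ≡ i) → lookup u j ≡ lookup v j)

data Walk {n : ℕ} : Vertex n → Vertex n → Set where
  here : (u : Vertex n) → Walk u u
  step : {u w v : Vertex n} → Adjacent u w → Walk w v → Walk u v

cost : ∀ {n} → (Vertex n → Bool) → {u v : Vertex n} → Walk u v → ℕ
cost f (here _) = 0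
cost f (step {u} {w} _ W) = (if does (f u ≟ᵇ f w) then 1 else 0) + cost f W
  where open import Data.Bool using (if_then_else_)

Optimal : ∀ {n} → (Vertex n → Bool) → {u v : Vertex n} → Walk u v → Set
Optimal f {u} {v} W = (W' : Walk u v) → cost f W ≤ cost f W'

-- Give a vertex the potential φ(w) = (parity of the weight of w) + f(w) in ℤ/2.
-- Along an edge the weight parity flips, so a step costs 1 exactly when φ
-- changes: the parity of the step cost is φ(w) + φ(w′). Summed along a walk
-- this telescopes, so every walk from u to v has cost of parity φ(u) + φ(v).
-- Hence no walk from u to v costs exactly c, and if none costs less than c, a
-- walk of cost c + 1 is optimal.
module Submission where

open import Defs
open import Algebra.Properties.CommutativeSemigroup using (interchange)
open import Data.Bool using (Bool; true; false; if_then_else_)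
open import Data.Bool.Properties using (_≟_)
open import Data.Fin using (zero; suc)
open import Data.Fin.Properties using (suc-injective)
open import Data.Nat as ℕ using (ℕ; suc; _≤_; _<_; parity)
open import Data.Nat.Properties using (m≤n⇒m<n∨m≡n; ≮⇒≥)
open import Data.Parity.Base using (Parity; 0ℙ; 1ℙ; _+_)
open import Data.Parity.Properties using (+-assoc; p+p≡0ℙ; p≢p⁻¹; +-homo-+; +-commutativeSemigroup)
open import Data.Product using (Σ; _×_; _,_)
open import Data.Sum using (inj₁; inj₂)
open import Data.Vec using ([]; _∷_)
open import Data.Vec.Relation.Binary.Pointwise.Extensional using (ext; Pointwise-≡⇒≡)
open import Function using (_∘_)
open import Relation.Nullary using (¬_; does; contradiction)
open import Relation.Binary.PropositionalEquality using (_≡_; _≢_; refl; sym; trans; cong; cong₂; subst; module ≡-Reasoning)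

open ≡-Reasoning

bit : Bool → Parity
bit false = 0ℙ
bit true  = 1ℙ

bit-≢ : ∀ {a b} → a ≢ b → bit a + bit b ≡ 1ℙ
bit-≢ {false} {false} a≢b = contradiction refl a≢b
bit-≢ {false} {true}  _   = refl
bit-≢ {true}  {false} _   = refl
bit-≢ {true}  {true}  a≢b = contradiction refl a≢b

parity-≟ : ∀ a b → parity (if does (a ≟ b) then 1 else 0) ≡ 1ℙ + (bit a + bit b)
parity-≟ false false = refl
parity-≟ false true  = refl
parity-≟ true  false = refl
parity-≟ true  true  = refl

telescope : ∀ p q r → (p + q) + (q + r) ≡ p + r
telescope p q r = begin
  (p + q) + (q + r)  ≡⟨ +-assoc p q (q + r) ⟩
  p + (q + (q + r))  ≡⟨ cong (p +_) (sym (+-assoc q q r)) ⟩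
  p + ((q + q) + r)  ≡⟨ cong (λ s → p + (s + r)) (p+p≡0ℙ q) ⟩
  p + r              ∎

≤∧parity≡⇒< : ∀ {m n} → m ≤ n → parity n ≡ parity (suc m) → m < n
≤∧parity≡⇒< {m} m≤n eq with m≤n⇒m<n∨m≡n m≤n
... | inj₁ m<n  = m<n
... | inj₂ refl = contradiction (trans eq (+-homo-+ 1 m)) (p≢p⁻¹ _)

weightParity : ∀ {n} → Vertex n → Parity
weightParity []      = 0ℙ
weightParity (b ∷ v) = bit b + weightParity v

weightParity-adjacent : ∀ {n} {u w : Vertex n} → Adjacent u w →
  weightParity u + weightParity w ≡ 1ℙ
weightParity-adjacent {u = a ∷ u} {b ∷ w} (zero , a≢b , agree) =
  trans (interchange +-commutativeSemigroup (bit a) (weightParity u) (bit b) (weightParity w))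
        (cong₂ _+_ (bit-≢ a≢b) tails-cancel)
  where
  tails-equal : u ≡ w
  tails-equal = Pointwise-≡⇒≡ (ext λ j → agree (suc j) λ ())
  tails-cancel : weightParity u + weightParity w ≡ 0ℙ
  tails-cancel = trans (cong (λ x → weightParity x + weightParity w) tails-equal) (p+p≡0ℙ (weightParity w))
weightParity-adjacent {u = a ∷ u} {b ∷ w} (suc i , a≢b , agree) =
  trans (interchange +-commutativeSemigroup (bit a) (weightParity u) (bit b) (weightParity w))
        (cong₂ _+_ heads-cancel (weightParity-adjacent {u = u} {w} tails-adjacent))
  where
  heads-cancel : bit a + bit b ≡ 0ℙ
  heads-cancel = trans (cong (λ x → bit x + bit b) (agree zero λ ())) (p+p≡0ℙ (bit b))
  tails-adjacent : Adjacent u w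
  tails-adjacent = i , a≢b , λ j j≢i → agree (suc j) (j≢i ∘ suc-injective)

potential : ∀ {n} → (Vertex n → Bool) → Vertex n → Parity
potential f w = weightParity w + bit (f w)

parity-stepCost : ∀ {n} (f : Vertex n → Bool) {u w : Vertex n} → Adjacent u w →
  parity (if does (f u ≟ f w) then 1 else 0) ≡ potential f u + potential f w
parity-stepCost f {u} {w} u~w = begin
  parity (if does (f u ≟ f w) then 1 else 0)
    ≡⟨ parity-≟ (f u) (f w) ⟩
  1ℙ + (bit (f u) + bit (f w))
    ≡⟨ cong (_+ (bit (f u) + bit (f w))) (sym (weightParity-adjacent {u = u} {w} u~w)) ⟩
  (weightParity u + weightParity w) + (bit (f u) + bit (f w))
    ≡⟨ interchange +-commutativeSemigroup (weightParity u) (weightParity w) (bit (f u)) (bit (f w)) ⟩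
  potential f u + potential f w
    ∎

parity-cost : ∀ {n} (f : Vertex n → Bool) {u v : Vertex n} (W : Walk u v) →
  parity (cost f W) ≡ potential f u + potential f v
parity-cost f (here u) = sym (p+p≡0ℙ (potential f u))
parity-cost f (step {u} {w} {v} u~w W) = begin
  parity (stepCost ℕ.+ cost f W)
    ≡⟨ +-homo-+ stepCost (cost f W) ⟩
  parity stepCost + parity (cost f W)
    ≡⟨ cong₂ _+_ (parity-stepCost f {u} {w} u~w) (parity-cost f W) ⟩
  (potential f u + potential f w) + (potential f w + potential f v)
    ≡⟨ telescope (potential f u) (potential f w) (potential f v) ⟩
  potential f u + potential f v
    ∎
  where
  stepCost : ℕ
  stepCost = if does (f u ≟ f w) then 1 else 0

parity-cost-walk-independent :
  ∀ {n} (f : Vertex n → Bool) {u v : Vertex n} (W W′ : Walk u v) →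
  parity (cost f W) ≡ parity (cost f W′)
parity-cost-walk-independent f W W′ = trans (parity-cost f W) (sym (parity-cost f W′))

optimal-if-cost-exceeds-lower-bound-by-one :
  ∀ {n} (f : Vertex n → Bool) {u v : Vertex n} (c : ℕ) →
  ¬ (Σ (Walk u v) λ W′ → cost f W′ < c) →
  (W : Walk u v) → cost f W ≡ suc c → Optimal f W
optimal-if-cost-exceeds-lower-bound-by-one f c no-cheaper W cost≡ W′ =
  subst (_≤ cost f W′) (sym cost≡) (≤∧parity≡⇒< c≤cost′ parity≡)
  where
  c≤cost′ : c ≤ cost f W′
  c≤cost′ = ≮⇒≥ (λ cost′<c → no-cheaper (W′ , cost′<c))
  parity≡ : parity (cost f W′) ≡ parity (suc c)
  parity≡ = trans (parity-cost-walk-independent f W′ W) (cong parity cost≡)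

corollary2 : ∀ {n} (f : Vertex n → Bool) (u v : Vertex n) →
    ((c : ℕ) → ¬ (Σ (Walk u v) λ W' → cost f W' < c) →
      (W : Walk u v) → cost f W ≡ suc c → Optimal f W)
  × ((W : Walk u v) → cost f W ≡ 1 → Optimal f W)
corollary2 f u v =
    optimal-if-cost-exceeds-lower-bound-by-one f
  , optimal-if-cost-exceeds-lower-bound-by-one f 0 (λ ())
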